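{- Let $N$ be a strongly tree-child $\mathcal{L}$-network with $n$ leaves and $t$ root components. Then $|V_H|\le n-t$. Moreover, if $N$ has no elementary nodes, then $$|V|\le 2n-t+\sum_{v\in V_H}\deg_i(v)\le (m+2)(n-t)+t,$$ where $m=\max_{v\in V_H}\deg_i(v)$, and $|E|\le(2m+1)(n-t)$.
   Context: A semidirected graph is $N=(V,E)$ with $E=E_U\sqcup E_D$, $E_U$ undirected edges $uv$, $E_D$ directed edges $(u,v)$ ($u$ parent, $v$ child); parallel directed edges allowed, no self-loops. $\deg_i(v)$, $\deg_o(v)$ are the numbers of directed edges with child $v$, resp. parent $v$; $\deg_u(v)$ the number of incident undirected edges; $\deg=\deg_i+\deg_o+\deg_u$. $N'$ is compatible with $N$ if obtained by directing some undirected edges. A semidirected cycle is a semidirected graph whose undirected edges can be directed to make it a directed cycle; acyclic (SDAG) means containing no semidirected cycle; DAG = acyclic directed graph. Tree node: $\deg_i\le1$; hybrid node otherwise; $V_H$ is the set of hybrid nodes. Hybrid edge: directed edge with hybrid child; $E_H(N)$ their set. SDAG $N'$ is phylogenetically compatible with SDAG $N$ if compatible and $E_H(N')=E_H(N)$; a rooted partner of $N$ is a DAG phylogenetically compatible with $N$; a network is an SDAG admitting a rooted partner. In a DAG, a leaf has out-degree 0; a DAG is tree-child if every non-leaf node has a child that is a tree node; a network is strongly tree-child if all its rooted partners are tree-child. A rooted leaf is a leaf in every rooted partner, an unrooted leaf a leaf in some rooted partner. For a vector $\mathcal{L}$ of distinct labels, an $\mathcal{L}$-network is a network whose sets of rooted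 and unrooted leaves coincide and are bijectively labeled by $\mathcal{L}$; these are its leaves. A semidirected path from $u_0$ to $u_n$ is $u_0\dots u_n$ with $u_{i-1}u_i$ or $(u_{i-1},u_i)$ an edge for each $i$; $v\lesssim u$ if there is a semidirected path from $u$ to $v$; $u\sim v$ if $u\lesssim v$ and $v\lesssim u$. An undirected component is the subgraph induced by a $\sim$-class; a root component is one whose class is maximal under $\lesssim$. A node $v$ of $N$ is elementary if it is a tree node and either $\deg_o(v)=\deg(v)=1$, or $\deg_o(v)<\deg(v)=2$. -}

module Defs where

open import Data.Nat using (ℕ; zero; suc; _+_; _*_; _≤_; _<_; _≤?_)
open import Data.Bool using (Bool; true; false; if_then_else_; _∧_; _∨_; not)
open import Data.Fin using (Fin; zero; suc; fromℕ; inject₁; _≟_)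
open import Data.Product using (Σ; ∃; ∃-syntax; _×_; _,_)
open import Data.Sum using (_⊎_)
open import Relation.Binary.PropositionalEquality using (_≡_; _≢_)
open import Relation.Nullary using (¬_)
open import Relation.Nullary.Decidable using (⌊_⌋)
open import Function.Definitions using (Injective)

count : ∀ {m} → (Fin m → Bool) → ℕ
count {zero}  p = 0
count {suc m} p = (if p zero then 1 else 0) + count (λ i → p (suc i))

sumF : ∀ {m} → (Fin m → ℕ) → ℕ
sumF {zero}  f = 0
sumF {suc m} f = f zero + sumF (λ i → f (suc i))

-- Semidirected (multi)graphs on nodes Fin n with edges indexed by Fin m.
-- U = undirected edge {src,tgt};  D = directed edge (src,tgt), src parent.

data Kind : Set where
  U D : Kind

isD : Kind → Bool
isD U = false
isD D = true

record Edge (n : ℕ) : Set where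
  constructor edge
  field
    kind : Kind
    src  : Fin n
    tgt  : Fin n
open Edge public

Graph : ℕ → ℕ → Set
Graph n m = Fin m → Edge n

-- No self-loops; parallel directed edges allowed; undirected edges form
-- a set of unordered pairs (no two undirected edges with the same ends).
record WellFormed {n m : ℕ} (G : Graph n m) : Set where
  field
    noLoop      : ∀ e → src (G e) ≢ tgt (G e)
    undirSimple : ∀ e f → kind (G e) ≡ U → kind (G f) ≡ U →
                  ((src (G e) ≡ src (G f) × tgt (G e) ≡ tgt (G f)) ⊎
                   (src (G e) ≡ tgt (G f) × tgt (G e) ≡ src (G f))) → e ≡ f

module _ {n m : ℕ} (G : Graph n m) where

  indeg : Fin n → ℕ
  indeg v = count (λ e → isD (kind (G e)) ∧ ⌊ tgt (G e) ≟ v ⌋)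

  outdeg : Fin n → ℕ
  outdeg v = count (λ e → isD (kind (G e)) ∧ ⌊ src (G e) ≟ v ⌋)

  undeg : Fin n → ℕ
  undeg v = count (λ e → not (isD (kind (G e))) ∧ (⌊ src (G e) ≟ v ⌋ ∨ ⌊ tgt (G e) ≟ v ⌋))

  deg : Fin n → ℕ
  deg v = indeg v + outdeg v + undeg v

  TreeNode : Fin n → Set
  TreeNode v = indeg v ≤ 1

  Hybrid : Fin n → Set
  Hybrid v = 2 ≤ indeg v

  isHybrid : Fin n → Bool
  isHybrid v = ⌊ 2 ≤? indeg v ⌋

  numHybrid : ℕ
  numHybrid = count isHybrid

  sumHybIndeg : ℕ
  sumHybIndeg = sumF (λ v → if isHybrid v then indeg v else 0)

  IsMaxHybIndeg : ℕ → Set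
  IsMaxHybIndeg k = (∃[ v ] (Hybrid v × indeg v ≡ k)) × (∀ v → Hybrid v → indeg v ≤ k)

  HybridEdge : Fin m → Set
  HybridEdge e = kind (G e) ≡ D × Hybrid (tgt (G e))

  Step : Fin m → Fin n → Fin n → Set
  Step e u v = (G e ≡ edge D u v) ⊎ (G e ≡ edge U u v) ⊎ (G e ≡ edge U v u)

  record SDCycle : Set where
    field
      len      : ℕ
      nodes    : Fin (suc len) → Fin n
      edges    : Fin (suc len) → Fin m
      steps    : ∀ (i : Fin len) → Step (edges (inject₁ i)) (nodes (inject₁ i)) (nodes (suc i))
      close    : Step (edges (fromℕ len)) (nodes (fromℕ len)) (nodes zero)
      nodesInj : Injective _≡_ _≡_ nodes
      edgesInj : Injective _≡_ _≡_ edges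

  Acyclic : Set
  Acyclic = ¬ SDCycle

  SDAG : Set
  SDAG = WellFormed G × Acyclic

  IsDAG : Set
  IsDAG = SDAG × (∀ e → kind (G e) ≡ D)

  data Path : Fin n → Fin n → Set where
    here : ∀ {u} → Path u u
    step : ∀ {u w v} e → Step e u w → Path w v → Path u v

  _≲_ : Fin n → Fin n → Set
  v ≲ u = Path u v

  _∼_ : Fin n → Fin n → Set
  u ∼ v = (u ≲ v) × (v ≲ u)

  -- v lies in a root component: its ∼-class is maximal under ≲
  InRootComponent : Fin n → Set
  InRootComponent r = ∀ u → r ≲ u → u ≲ r

  -- the root components are in bijection with Fin t
  HasRootComponents : ℕ → Set
  HasRootComponents t =
    Σ (Fin t → Fin n) λ rep →
      (∀ i → InRootComponent (rep i)) ×
      (∀ i j → rep i ∼ rep j → i ≡ j) ×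
      (∀ v → InRootComponent v → ∃[ i ] (v ∼ rep i))

  Elementary : Fin n → Set
  Elementary v = TreeNode v ×
    ((outdeg v ≡ 1 × deg v ≡ 1) ⊎ (outdeg v < deg v × deg v ≡ 2))

  IsLeaf : Fin n → Set
  IsLeaf v = outdeg v ≡ 0

  TreeChild : Set
  TreeChild = ∀ v → outdeg v ≢ 0 →
    ∃[ e ] (kind (G e) ≡ D × src (G e) ≡ v × TreeNode (tgt (G e)))

Refines : ∀ {n} → Edge n → Edge n → Set
Refines e' (edge U u v) = (e' ≡ edge U u v) ⊎ (e' ≡ edge D u v) ⊎ (e' ≡ edge D v u)
Refines e' (edge D u v) = e' ≡ edge D u v

Compatible : ∀ {n m} → Graph n m → Graph n m → Set
Compatible G' G = ∀ e → Refines (G' e) (G e)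

PhyloCompatible : ∀ {n m} → Graph n m → Graph n m → Set
PhyloCompatible G' G = SDAG G' × SDAG G × Compatible G' G ×
  (∀ e → (HybridEdge G' e → HybridEdge G e) × (HybridEdge G e → HybridEdge G' e))

RootedPartner : ∀ {n m} → Graph n m → Graph n m → Set
RootedPartner G' G = IsDAG G' × PhyloCompatible G' G

IsNetwork : ∀ {n m} → Graph n m → Set
IsNetwork {n} {m} G = SDAG G × ∃[ G' ] RootedPartner {n} {m} G' G

StronglyTreeChild : ∀ {n m} → Graph n m → Set
StronglyTreeChild {n} {m} G = IsNetwork G × (∀ (G' : Graph n m) → RootedPartner G' G → TreeChild G')

RootedLeaf : ∀ {n m} → Graph n m → Fin n → Set
RootedLeaf {n} {m} G v = ∀ (G' : Graph n m) → RootedPartner G' G → IsLeaf G' v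

UnrootedLeaf : ∀ {n m} → Graph n m → Fin n → Set
UnrootedLeaf {n} {m} G v = ∃[ G' ] (RootedPartner {n} {m} G' G × IsLeaf G' v)

-- L-network with label set Fin k (|L| = k leaves)
LNetwork : ∀ {n m} → Graph n m → ℕ → Set
LNetwork {n} G k = IsNetwork G ×
  (∀ v → RootedLeaf G v → UnrootedLeaf G v) ×
  (∀ v → UnrootedLeaf G v → RootedLeaf G v) ×
  Σ (Fin k → Fin n) λ lab →
    Injective _≡_ _≡_ lab × (∀ i → RootedLeaf G (lab i)) ×
    (∀ v → RootedLeaf G v → ∃[ i ] (lab i ≡ v))

module Submission where

-- Fix a rooted partner R of N: a tree-child DAG with the same hybrid nodes, and the same hybrid in-degrees,
-- as N. Sort its nodes by in-degree into s sources, t₁ nodes of in-degree one and h hybrids. Sending a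
-- non-leaf to its tree child is injective, so the l leaves satisfy h + s ≤ l. Leaves of R are leaves of N,
-- so l ≤ n, and every root component of N lies below a source of R of its own, so t ≤ s; hence h + t ≤ n.
-- Without elementary nodes every non-hybrid non-leaf of R has at least two children (a source whose only
-- out-edge is undirected in N could be reoriented into a leaf), so 2|V| ≤ 2l + h + |E|, while
-- |E| = t₁ + Σ_{v ∈ V_H} deg_i(v).

open import Defs
open import Data.Bool using (Bool; true; false; if_then_else_; _∧_; _∨_; not)
open import Data.Bool.Properties using (∧-identityʳ)
open import Data.Empty using (⊥-elim)
open import Data.Fin using (Fin; zero; suc; _≟_; inject₁; fromℕ)
open import Data.Fin.Properties using (suc-injective; inject₁-injective; injective⇒≤; any?)
open import Data.Nat using (ℕ; zero; suc; _+_; _*_; _≤_; _<_; z≤n; s≤s; _≤?_)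
import Data.Nat as ℕ
open import Data.Nat.Properties
  using ( +-suc; +-comm; +-identityʳ; *-identityʳ; *-zeroʳ; *-distribˡ-+; +-commutativeSemigroup
        ; ≤-refl; ≤-reflexive; ≤-trans; ≤-antisym; ≤-pred; <⇒≱; ≰⇒>; 1+n≰n
        ; +-mono-≤; +-monoˡ-≤; +-monoʳ-≤; *-monoʳ-≤; +-cancelʳ-≤; module ≤-Reasoning )
open import Data.Nat.Tactic.RingSolver using (solve-∀)
open import Algebra.Properties.CommutativeSemigroup +-commutativeSemigroup using (interchange)
open import Data.Product using (∃-syntax; _×_; _,_; proj₁; proj₂)
open import Data.Sum using (_⊎_; inj₁; inj₂)
open import Data.Vec.Functional using (_∷_)
open import Function using (case_of_)
open import Function.Definitions using (Injective)
open import Relation.Binary.PropositionalEquality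
open import Relation.Nullary using (¬_; Dec; yes; no)
open import Relation.Nullary.Decidable using (⌊_⌋)

ind : Bool → ℕ
ind b = if b then 1 else 0

sumF-cong : ∀ {n} {f g : Fin n → ℕ} → (∀ i → f i ≡ g i) → sumF f ≡ sumF g
sumF-cong {zero}  f≗g = refl
sumF-cong {suc n} f≗g = cong₂ _+_ (f≗g zero) (sumF-cong (λ i → f≗g (suc i)))

sumF-mono : ∀ {n} {f g : Fin n → ℕ} → (∀ i → f i ≤ g i) → sumF f ≤ sumF g
sumF-mono {zero}  f≤g = z≤n
sumF-mono {suc n} f≤g = +-mono-≤ (f≤g zero) (sumF-mono (λ i → f≤g (suc i)))

sumF-+ : ∀ {n} (f g : Fin n → ℕ) → sumF (λ i → f i + g i) ≡ sumF f + sumF g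
sumF-+ {zero}  f g = refl
sumF-+ {suc n} f g = trans (cong (f zero + g zero +_) (sumF-+ (λ i → f (suc i)) (λ i → g (suc i))))
                           (interchange (f zero) (g zero) _ _)

sumF-* : ∀ {n} c (f : Fin n → ℕ) → sumF (λ i → c * f i) ≡ c * sumF f
sumF-* {zero}  c f = sym (*-zeroʳ c)
sumF-* {suc n} c f = trans (cong (c * f zero +_) (sumF-* c (λ i → f (suc i))))
                           (sym (*-distribˡ-+ c (f zero) _))

sumF-+₃ : ∀ {n} (f g h : Fin n → ℕ) → sumF (λ i → f i + g i + h i) ≡ sumF f + sumF g + sumF h
sumF-+₃ f g h = trans (sumF-+ (λ i → f i + g i) h) (cong (_+ sumF h) (sumF-+ f g))

sumF-zero : ∀ {n} → sumF {n} (λ _ → 0) ≡ 0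
sumF-zero {zero}  = refl
sumF-zero {suc n} = sumF-zero {n}

sumF-one : ∀ {n} → sumF {n} (λ _ → 1) ≡ n
sumF-one {zero}  = refl
sumF-one {suc n} = cong suc (sumF-one {n})

sumF-swap : ∀ {a b} (f : Fin a → Fin b → ℕ) →
            sumF (λ i → sumF (λ j → f i j)) ≡ sumF (λ j → sumF (λ i → f i j))
sumF-swap {zero}  {b} f = sym (sumF-zero {b})
sumF-swap {suc a} {b} f =
  trans (cong (sumF (f zero) +_) (sumF-swap (λ i → f (suc i))))
        (sym (sumF-+ (f zero) (λ j → sumF (λ i → f (suc i) j))))

-- Only propositional: both sides are stuck on the decision x ≟ y, in different ways.
≟-suc : ∀ {n} (x y : Fin n) → ⌊ suc x ≟ suc y ⌋ ≡ ⌊ x ≟ y ⌋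
≟-suc x y with x ≟ y
... | yes _ = refl
... | no  _ = refl

sumF-indicator : ∀ {n} (x : Fin n) → sumF (λ v → ind ⌊ x ≟ v ⌋) ≡ 1
sumF-indicator {suc n} zero    = cong suc (sumF-zero {n})
sumF-indicator {suc n} (suc x) = trans (sumF-cong (λ i → cong ind (≟-suc x i))) (sumF-indicator x)

count≡sumF-ind : ∀ {n} (p : Fin n → Bool) → count p ≡ sumF (λ i → ind (p i))
count≡sumF-ind {zero}  p = refl
count≡sumF-ind {suc n} p = cong (ind (p zero) +_) (count≡sumF-ind (λ i → p (suc i)))

count-cong : ∀ {n} {p q : Fin n → Bool} → (∀ i → p i ≡ q i) → count p ≡ count q
count-cong {zero}  p≗q = refl
count-cong {suc n} p≗q = cong₂ _+_ (cong ind (p≗q zero)) (count-cong (λ i → p≗q (suc i)))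

count-const-true : ∀ {n} → count {n} (λ _ → true) ≡ n
count-const-true {zero}  = refl
count-const-true {suc n} = cong suc (count-const-true {n})

count-witness : ∀ {n} (p : Fin n → Bool) → count p ≢ 0 → ∃[ i ] p i ≡ true
count-witness {zero}  p count≢0 = ⊥-elim (count≢0 refl)
count-witness {suc n} p count≢0 with p zero in p₀
... | true  = zero , p₀
... | false with i , pᵢ ← count-witness (λ i → p (suc i)) count≢0 = suc i , pᵢ

count-remove : ∀ {n} (p : Fin n → Bool) {a} → p a ≡ true →
               count p ≡ suc (count (λ i → p i ∧ not ⌊ i ≟ a ⌋))
count-remove {suc n} p {zero} pₐ rewrite pₐ =
  cong suc (count-cong (λ i → sym (∧-identityʳ (p (suc i)))))
count-remove {suc n} p {suc a} pₐ = begin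
  ind (p zero) + count (λ i → p (suc i))
    ≡⟨ cong (ind (p zero) +_) (count-remove (λ i → p (suc i)) pₐ) ⟩
  ind (p zero) + suc (count (λ i → p (suc i) ∧ not ⌊ i ≟ a ⌋))
    ≡⟨ +-suc (ind (p zero)) _ ⟩
  suc (ind (p zero) + count (λ i → p (suc i) ∧ not ⌊ i ≟ a ⌋))
    ≡⟨ cong₂ (λ b c → suc (ind b + c)) (sym (∧-identityʳ (p zero)))
             (count-cong (λ i → cong (λ b → p (suc i) ∧ not b) (sym (≟-suc i a)))) ⟩
  suc (ind (p zero ∧ true) + count (λ i → p (suc i) ∧ not ⌊ suc i ≟ suc a ⌋)) ∎
  where open ≡-Reasoning

count-≤-injection : ∀ {n n′} (p : Fin n → Bool) (q : Fin n′ → Bool)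
  (f : ∀ i → p i ≡ true → Fin n′) → (∀ i pᵢ → q (f i pᵢ) ≡ true) →
  (∀ i j pᵢ pⱼ → f i pᵢ ≡ f j pⱼ → i ≡ j) → count p ≤ count q
count-≤-injection {zero} p q f f-sound f-inj = z≤n
count-≤-injection {suc n} p q f f-sound f-inj with p zero in p₀
... | false = count-≤-injection (λ i → p (suc i)) q (λ i → f (suc i)) (λ i → f-sound (suc i))
                (λ i j pᵢ pⱼ eq → suc-injective (f-inj _ _ pᵢ pⱼ eq))
... | true  = begin
  suc (count (λ i → p (suc i)))
    ≤⟨ s≤s (count-≤-injection (λ i → p (suc i)) q′ (λ i → f (suc i)) f′-sound
              (λ i j pᵢ pⱼ eq → suc-injective (f-inj _ _ pᵢ pⱼ eq))) ⟩
  suc (count q′)   ≡⟨ count-remove q (f-sound zero p₀) ⟨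
  count q          ∎
  where
  open ≤-Reasoning
  a = f zero p₀
  q′ : Fin _ → Bool
  q′ j = q j ∧ not ⌊ j ≟ a ⌋
  f′-sound : ∀ i pᵢ → q′ (f (suc i) pᵢ) ≡ true
  f′-sound i pᵢ rewrite f-sound (suc i) pᵢ with f (suc i) pᵢ ≟ a
  ... | yes eq = case f-inj (suc i) zero pᵢ p₀ eq of λ ()
  ... | no _   = refl

count-mono : ∀ {n} {p q : Fin n → Bool} → (∀ i → p i ≡ true → q i ≡ true) → count p ≤ count q
count-mono {p = p} {q} p⇒q = count-≤-injection p q (λ i _ → i) p⇒q (λ _ _ _ _ eq → eq)

count-false : ∀ {n} {p : Fin n → Bool} → (∀ i → p i ≡ false) → count p ≡ 0
count-false {zero}          never = refl
count-false {suc n} {p} never rewrite never zero = count-false (λ i → never (suc i))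

count-≤1 : ∀ {n} {p : Fin n → Bool} (a : Fin n) → (∀ i → p i ≡ true → i ≡ a) → count p ≤ 1
count-≤1 {p = p} a only-a = count-≤-injection p (λ (_ : Fin 1) → true) (λ _ _ → zero) (λ _ _ → refl)
                              (λ i j pᵢ pⱼ _ → trans (only-a i pᵢ) (sym (only-a j pⱼ)))

count-≥1 : ∀ {n} {p : Fin n → Bool} {a} → p a ≡ true → 1 ≤ count p
count-≥1 {p = p} pₐ rewrite count-remove p pₐ = s≤s z≤n

count≡1⇒unique : ∀ {n} {p : Fin n → Bool} {a b} → count p ≡ 1 → p a ≡ true → p b ≡ true → b ≡ a
count≡1⇒unique {p = p} {a} {b} count≡1 pₐ p_b with b ≟ a
... | yes b≡a = b≡a
... | no  b≢a = ⊥-elim (1+n≰n (begin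
      2                                           ≤⟨ s≤s (count-≥1 {p = λ i → p i ∧ not ⌊ i ≟ a ⌋} p∖a-b) ⟩
      suc (count (λ i → p i ∧ not ⌊ i ≟ a ⌋))     ≡⟨ count-remove p pₐ ⟨
      count p                                     ≡⟨ count≡1 ⟩
      1                                           ∎))
  where
  open ≤-Reasoning
  p∖a-b : (p b ∧ not ⌊ b ≟ a ⌋) ≡ true
  p∖a-b rewrite p_b with b ≟ a
  ... | yes b≡a = ⊥-elim (b≢a b≡a)
  ... | no  _   = refl

count-complement : ∀ {n} (p : Fin n → Bool) → count p + count (λ i → not (p i)) ≡ n
count-complement {zero}  p = refl
count-complement {suc n} p with p zero
... | true  = cong suc (count-complement (λ i → p (suc i)))
... | false = trans (+-suc _ _) (cong suc (count-complement (λ i → p (suc i))))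

isYes-sound : ∀ {P : Set} (P? : Dec P) → ⌊ P? ⌋ ≡ true → P
isYes-sound (yes p) _ = p

isYes-complete : ∀ {P : Set} (P? : Dec P) → P → ⌊ P? ⌋ ≡ true
isYes-complete (yes _) _ = refl
isYes-complete (no ¬p) p = ⊥-elim (¬p p)

isYes-complete⁻ : ∀ {P : Set} (P? : Dec P) → ¬ P → ⌊ P? ⌋ ≡ false
isYes-complete⁻ (yes p) ¬p = ⊥-elim (¬p p)
isYes-complete⁻ (no _)  _  = refl

≤1⇒≡0⊎≡1 : ∀ {x} → x ≤ 1 → x ≡ 0 ⊎ x ≡ 1
≤1⇒≡0⊎≡1 z≤n       = inj₁ refl
≤1⇒≡0⊎≡1 (s≤s z≤n) = inj₂ refl

-- Defs' indeg G v, outdeg G v and undeg G v are, definitionally, the counts of the e with these flags on G e.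
incoming outgoing undirectedAt : ∀ {n} → Fin n → Edge n → Bool
incoming     v x = isD (kind x) ∧ ⌊ tgt x ≟ v ⌋
outgoing     v x = isD (kind x) ∧ ⌊ src x ≟ v ⌋
undirectedAt v x = not (isD (kind x)) ∧ (⌊ src x ≟ v ⌋ ∨ ⌊ tgt x ≟ v ⌋)

isD∧≟-sound : ∀ {n} k {x v : Fin n} → (isD k ∧ ⌊ x ≟ v ⌋) ≡ true → k ≡ D × x ≡ v
isD∧≟-sound D {x} {v} h = refl , isYes-sound (x ≟ v) h

isD∧≟-complete : ∀ {n} {k} {x v : Fin n} → k ≡ D → x ≡ v → (isD k ∧ ⌊ x ≟ v ⌋) ≡ true
isD∧≟-complete {x = x} {v} refl x≡v = isYes-complete (x ≟ v) x≡v

incoming-sound : ∀ {n} {v : Fin n} x → incoming v x ≡ true → kind x ≡ D × tgt x ≡ v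
incoming-sound x = isD∧≟-sound (kind x)

outgoing-sound : ∀ {n} {v : Fin n} x → outgoing v x ≡ true → kind x ≡ D × src x ≡ v
outgoing-sound x = isD∧≟-sound (kind x)

Directed : ∀ {n m} → Graph n m → Set
Directed G = ∀ e → kind (G e) ≡ D

module _ {n m} (G : Graph n m) where

  indeg-≥1 : ∀ {v} e → kind (G e) ≡ D → tgt (G e) ≡ v → 1 ≤ indeg G v
  indeg-≥1 {v} e kind≡D tgt≡v = count-≥1 {p = λ e → incoming v (G e)} {e} (isD∧≟-complete kind≡D tgt≡v)

  outdeg-≥1 : ∀ {v} e → kind (G e) ≡ D → src (G e) ≡ v → 1 ≤ outdeg G v
  outdeg-≥1 {v} e kind≡D src≡v = count-≥1 {p = λ e → outgoing v (G e)} {e} (isD∧≟-complete kind≡D src≡v)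

sumF-count-endpoint : ∀ {n m} (end : Fin m → Fin n) → sumF (λ v → count (λ e → ⌊ end e ≟ v ⌋)) ≡ m
sumF-count-endpoint {n} {m} end = begin
  sumF (λ v → count (λ e → ⌊ end e ≟ v ⌋))
    ≡⟨ sumF-cong (λ v → count≡sumF-ind (λ e → ⌊ end e ≟ v ⌋)) ⟩
  sumF (λ v → sumF (λ e → ind ⌊ end e ≟ v ⌋))
    ≡⟨ sumF-swap (λ v e → ind ⌊ end e ≟ v ⌋) ⟩
  sumF (λ e → sumF (λ v → ind ⌊ end e ≟ v ⌋))
    ≡⟨ sumF-cong (λ e → sumF-indicator (end e)) ⟩
  sumF {m} (λ _ → 1)
    ≡⟨ sumF-one ⟩
  m ∎
  where open ≡-Reasoning

module _ {n m} {G : Graph n m} (directed : Directed G) where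

  sumF-indeg : sumF (indeg G) ≡ m
  sumF-indeg = trans (sumF-cong λ v → count-cong λ e → cong (λ k → isD k ∧ ⌊ tgt (G e) ≟ v ⌋) (directed e))
                     (sumF-count-endpoint (λ e → tgt (G e)))

  sumF-outdeg : sumF (outdeg G) ≡ m
  sumF-outdeg = trans (sumF-cong λ v → count-cong λ e → cong (λ k → isD k ∧ ⌊ src (G e) ≟ v ⌋) (directed e))
                      (sumF-count-endpoint (λ e → src (G e)))

  deg-directed : ∀ v → deg G v ≡ indeg G v + outdeg G v
  deg-directed v = trans (cong (indeg G v + outdeg G v +_) undeg≡0) (+-identityʳ _)
    where
    undeg≡0 : undeg G v ≡ 0
    undeg≡0 = count-false λ e →
      cong (λ k → not (isD k) ∧ (⌊ src (G e) ≟ v ⌋ ∨ ⌊ tgt (G e) ≟ v ⌋)) (directed e)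

contribution : ∀ {n} → Edge n → Fin n → ℕ
contribution x v = ind (incoming v x) + ind (outgoing v x) + ind (undirectedAt v x)

deg≡sumF-contribution : ∀ {n m} (G : Graph n m) v → deg G v ≡ sumF (λ e → contribution (G e) v)
deg≡sumF-contribution G v = begin
  indeg G v + outdeg G v + undeg G v
    ≡⟨ cong₂ _+_ (cong₂ _+_ (count≡sumF-ind (λ e → incoming v (G e))) (count≡sumF-ind (λ e → outgoing v (G e))))
                 (count≡sumF-ind (λ e → undirectedAt v (G e))) ⟩
  sumF (λ e → ind (incoming v (G e))) + sumF (λ e → ind (outgoing v (G e))) + sumF (λ e → ind (undirectedAt v (G e)))
    ≡⟨ sumF-+₃ (λ e → ind (incoming v (G e))) (λ e → ind (outgoing v (G e))) (λ e → ind (undirectedAt v (G e))) ⟨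
  sumF (λ e → contribution (G e) v) ∎
  where open ≡-Reasoning

-- An undirected edge between distinct nodes contributes to deg v exactly what either orientation does.
ind-∨-≟ : ∀ {n} {a b : Fin n} v → a ≢ b →
          ind (⌊ a ≟ v ⌋ ∨ ⌊ b ≟ v ⌋) ≡ ind ⌊ b ≟ v ⌋ + ind ⌊ a ≟ v ⌋ + 0
ind-∨-≟ {a = a} {b} v a≢b with a ≟ v | b ≟ v
... | yes a≡v | yes b≡v = ⊥-elim (a≢b (trans a≡v (sym b≡v)))
... | yes _   | no  _   = refl
... | no  _   | yes _   = refl
... | no  _   | no  _   = refl

contribution-refines : ∀ {n} {x y : Edge n} v → src x ≢ tgt x → Refines y x → contribution y v ≡ contribution x v
contribution-refines {x = edge D a b} v _ refl = refl
contribution-refines {x = edge U a b} v _ (inj₁ refl) = refl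
contribution-refines {x = edge U a b} v a≢b (inj₂ (inj₁ refl)) = sym (ind-∨-≟ v a≢b)
contribution-refines {x = edge U a b} v a≢b (inj₂ (inj₂ refl)) =
  sym (trans (ind-∨-≟ v a≢b) (cong (_+ 0) (+-comm (ind ⌊ b ≟ v ⌋) _)))

deg-compatible : ∀ {n m} {G′ G : Graph n m} → (∀ e → src (G e) ≢ tgt (G e)) → Compatible G′ G →
                 ∀ v → deg G′ v ≡ deg G v
deg-compatible {G′ = G′} {G} loopless compatible v = begin
  deg G′ v                            ≡⟨ deg≡sumF-contribution G′ v ⟩
  sumF (λ e → contribution (G′ e) v)  ≡⟨ sumF-cong (λ e → contribution-refines v (loopless e) (compatible e)) ⟩
  sumF (λ e → contribution (G e) v)   ≡⟨ deg≡sumF-contribution G v ⟨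
  deg G v                             ∎
  where open ≡-Reasoning

directed-step : ∀ {n m} {G : Graph n m} → Directed G → ∀ {e a b} → Step G e a b → G e ≡ edge D a b
directed-step directed     (inj₁ Gₑ≡)        = Gₑ≡
directed-step directed {e} (inj₂ (inj₁ Gₑ≡)) = case trans (sym (cong kind Gₑ≡)) (directed e) of λ ()
directed-step directed {e} (inj₂ (inj₂ Gₑ≡)) = case trans (sym (cong kind Gₑ≡)) (directed e) of λ ()

refinement-step : ∀ {n} {x : Edge n} {a b} → Refines (edge D a b) x →
                  (x ≡ edge D a b) ⊎ (x ≡ edge U a b) ⊎ (x ≡ edge U b a)
refinement-step {x = edge D _ _} refl               = inj₁ refl
refinement-step {x = edge U _ _} (inj₂ (inj₁ refl)) = inj₂ (inj₁ refl)
refinement-step {x = edge U _ _} (inj₂ (inj₂ refl)) = inj₂ (inj₂ refl)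

module Partner {n m} {R N : Graph n m} (partner : RootedPartner R N) where

  directed : Directed R
  directed = proj₂ (proj₁ partner)

  R-sdag : SDAG R
  R-sdag = proj₁ (proj₁ partner)

  N-sdag : SDAG N
  N-sdag = proj₁ (proj₂ (proj₂ partner))

  compatible : Compatible R N
  compatible = proj₁ (proj₂ (proj₂ (proj₂ partner)))

  hybridEdges : ∀ e → (HybridEdge R e → HybridEdge N e) × (HybridEdge N e → HybridEdge R e)
  hybridEdges = proj₂ (proj₂ (proj₂ (proj₂ partner)))

  refines-directed : ∀ e → kind (N e) ≡ D → R e ≡ N e
  refines-directed e kind≡D with N e | compatible e
  ... | edge D _ _ | R≡N = R≡N

  indeg-≤ : ∀ v → indeg N v ≤ indeg R v
  indeg-≤ v = count-mono λ e inₑ →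
    subst (λ x → incoming v x ≡ true) (sym (refines-directed e (proj₁ (incoming-sound (N e) inₑ)))) inₑ

  outdeg-≤ : ∀ v → outdeg N v ≤ outdeg R v
  outdeg-≤ v = count-mono λ e outₑ →
    subst (λ x → outgoing v x ≡ true) (sym (refines-directed e (proj₁ (outgoing-sound (N e) outₑ)))) outₑ

  -- The in-edges of a hybrid node of R are hybrid edges, hence directed already in N.
  indeg-hybrid : ∀ v → Hybrid R v → indeg N v ≡ indeg R v
  indeg-hybrid v hybrid = ≤-antisym (indeg-≤ v) (count-mono λ e inₑ →
    let kind≡D , tgt≡v = incoming-sound (R e) inₑ
        hybridEdge     = proj₁ (hybridEdges e) (kind≡D , subst (Hybrid R) (sym tgt≡v) hybrid)
    in subst (λ x → incoming v x ≡ true) (refines-directed e (proj₁ hybridEdge)) inₑ)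

  isHybrid-≡ : ∀ v → isHybrid N v ≡ isHybrid R v
  isHybrid-≡ v with 2 ≤? indeg N v | 2 ≤? indeg R v
  ... | yes _  | yes _  = refl
  ... | no _   | no _   = refl
  ... | yes hN | no ¬hR = ⊥-elim (¬hR (≤-trans hN (indeg-≤ v)))
  ... | no ¬hN | yes hR = ⊥-elim (¬hN (subst (2 ≤_) (sym (indeg-hybrid v hR)) hR))

  numHybrid-≡ : numHybrid N ≡ numHybrid R
  numHybrid-≡ = count-cong isHybrid-≡

  sumHybIndeg-≡ : sumHybIndeg N ≡ sumHybIndeg R
  sumHybIndeg-≡ = sumF-cong hybIndeg-≡
    where
    hybIndeg-≡ : ∀ v → (if isHybrid N v then indeg N v else 0) ≡ (if isHybrid R v then indeg R v else 0)
    hybIndeg-≡ v rewrite isHybrid-≡ v with 2 ≤? indeg R v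
    ... | yes hR = indeg-hybrid v hR
    ... | no  _  = refl

  deg-≡ : ∀ v → deg N v ≡ indeg R v + outdeg R v
  deg-≡ v = trans (sym (deg-compatible (WellFormed.noLoop (proj₁ N-sdag)) compatible v)) (deg-directed directed v)

  lift-path : ∀ {a b} → Path R a b → Path N a b
  lift-path here         = here
  lift-path (step e s p) =
    step e (refinement-step (subst (λ x → Refines x (N e)) (directed-step {G = R} directed s) (compatible e))) (lift-path p)

inject₁-or-fromℕ : ∀ {r} (j : Fin (suc r)) → (∃[ i ] j ≡ inject₁ i) ⊎ j ≡ fromℕ r
inject₁-or-fromℕ {zero}  zero    = inj₂ refl
inject₁-or-fromℕ {suc r} zero    = inj₁ (zero , refl)
inject₁-or-fromℕ {suc r} (suc j) with inject₁-or-fromℕ j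
... | inj₁ (i , refl) = inj₁ (suc i , refl)
... | inj₂ refl       = inj₂ refl

snoc : ∀ {A : Set} {r} → (Fin r → A) → A → Fin (suc r) → A
snoc {r = zero}  f a _       = a
snoc {r = suc r} f a zero    = f zero
snoc {r = suc r} f a (suc j) = snoc (λ i → f (suc i)) a j

snoc-inject₁ : ∀ {A : Set} {r} (f : Fin r → A) a i → snoc f a (inject₁ i) ≡ f i
snoc-inject₁ {r = suc r} f a zero    = refl
snoc-inject₁ {r = suc r} f a (suc i) = snoc-inject₁ (λ i → f (suc i)) a i

snoc-fromℕ : ∀ {A : Set} {r} (f : Fin r → A) a → snoc f a (fromℕ r) ≡ a
snoc-fromℕ {r = zero}  f a = refl
snoc-fromℕ {r = suc r} f a = snoc-fromℕ (λ i → f (suc i)) a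

_++ₚ_ : ∀ {n m} {G : Graph n m} {a b c} → Path G a b → Path G b c → Path G a c
here         ++ₚ q = q
step e s p   ++ₚ q = step e s (p ++ₚ q)

record DirectedWalk {n m} (G : Graph n m) (r : ℕ) : Set where
  field
    node           : Fin (suc r) → Fin n
    node-injective : Injective _≡_ _≡_ node
    arc            : Fin r → Fin m
    arc-spec       : ∀ j → G (arc j) ≡ edge D (node (inject₁ j)) (node (suc j))

module _ {n m} {G : Graph n m} where
  open DirectedWalk

  dropLast : ∀ {r} → DirectedWalk G (suc r) → DirectedWalk G r
  dropLast w = record
    { node           = λ i → node w (inject₁ i)
    ; node-injective = λ eq → inject₁-injective (node-injective w eq)
    ; arc            = λ j → arc w (inject₁ j)
    ; arc-spec       = λ j → arc-spec w (inject₁ j)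
    }

  prepend : ∀ {r} (w : DirectedWalk G r) {p e} → G e ≡ edge D p (node w zero) →
            (∀ i → node w i ≢ p) → DirectedWalk G (suc r)
  prepend w {p} {e} Gₑ≡ fresh = record
    { node = p ∷ node w ; node-injective = injective ; arc = e ∷ arc w ; arc-spec = spec }
    where
    injective : Injective _≡_ _≡_ (p ∷ node w)
    injective {zero}  {zero}  _  = refl
    injective {zero}  {suc j} eq = ⊥-elim (fresh j (sym eq))
    injective {suc i} {zero}  eq = ⊥-elim (fresh i eq)
    injective {suc i} {suc j} eq = cong suc (node-injective w eq)
    spec : ∀ j → G ((e ∷ arc w) j) ≡ edge D ((p ∷ node w) (inject₁ j)) ((p ∷ node w) (suc j))
    spec zero    = Gₑ≡
    spec (suc j) = arc-spec w j

  closeWalk : ∀ {r} (w : DirectedWalk G r) {e} → G e ≡ edge D (node w (fromℕ r)) (node w zero) → SDCycle G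
  closeWalk {r} w {e} Gₑ≡ = record
    { len      = r
    ; nodes    = node w
    ; edges    = snoc (arc w) e
    ; steps    = λ i → inj₁ (trans (cong G (snoc-inject₁ (arc w) e i)) (arc-spec w i))
    ; close    = inj₁ (trans (cong G (snoc-fromℕ (arc w) e)) Gₑ≡)
    ; nodesInj = node-injective w
    ; edgesInj = λ eq → node-injective w (trans (sym (src-arc _)) (trans (cong (λ a → src (G a)) eq) (src-arc _)))
    }
    where
    src-arc : ∀ j → src (G (snoc (arc w) e j)) ≡ node w j
    src-arc j with inject₁-or-fromℕ j
    ... | inj₁ (i , refl) = trans (cong (λ a → src (G a)) (snoc-inject₁ (arc w) e i)) (cong src (arc-spec w i))
    ... | inj₂ refl       = trans (cong (λ a → src (G a)) (snoc-fromℕ (arc w) e)) (cong src Gₑ≡)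

  closeWalkAt : ∀ {r} (w : DirectedWalk G r) i {e} → G e ≡ edge D (node w i) (node w zero) → SDCycle G
  closeWalkAt w i Gₑ≡ with inject₁-or-fromℕ i
  closeWalkAt {zero}  w _ Gₑ≡ | inj₁ (() , _)
  closeWalkAt {suc r} w _ Gₑ≡ | inj₁ (i , refl) = closeWalkAt (dropLast w) i Gₑ≡
  closeWalkAt         w _ Gₑ≡ | inj₂ refl       = closeWalk w Gₑ≡

  in-edge : ∀ {v e} → incoming v (G e) ≡ true → G e ≡ edge D (src (G e)) v
  in-edge {v} {e} inₑ = let kind≡D , tgt≡v = incoming-sound (G e) inₑ in
    cong₂ (λ k t → edge k (src (G e)) t) kind≡D tgt≡v

  -- Climb along in-edges; an injective walk cannot outgrow the n nodes, and closing it would create a cycle.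
  source-above : Acyclic G → ∀ v → ∃[ s ] (indeg G s ≡ 0 × Path G s v)
  source-above acyclic v = climb n 0 ≤-refl start here
    where
    start : DirectedWalk G 0
    start = record { node = λ _ → v ; node-injective = λ { {zero} {zero} _ → refl } ; arc = λ () ; arc-spec = λ () }
    climb : ∀ fuel r → n ≤ r + fuel → (w : DirectedWalk G r) → Path G (node w zero) v →
            ∃[ s ] (indeg G s ≡ 0 × Path G s v)
    climb zero r n≤r w _ =
      ⊥-elim (<⇒≱ (injective⇒≤ (node-injective w)) (subst (n ≤_) (+-identityʳ r) n≤r))
    climb (suc fuel) r n≤ w path with indeg G (node w zero) ℕ.≟ 0
    ... | yes indeg≡0 = node w zero , indeg≡0 , path
    ... | no  indeg≢0 with e , inₑ ← count-witness _ indeg≢0 with any? (λ i → node w i ≟ src (G e))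
    ...   | yes (i , nodeᵢ≡) =
      ⊥-elim (acyclic (closeWalkAt w i (trans (in-edge inₑ) (cong (λ x → edge D x _) (sym nodeᵢ≡)))))
    ...   | no  fresh =
      climb fuel (suc r) (subst (n ≤_) (+-suc r fuel) n≤) (prepend w (in-edge inₑ) (λ i eq → fresh (i , eq)))
            (step e (inj₁ (in-edge inₑ)) path)

module _ {n m} {G : Graph n m} where
  open SDCycle

  cycle-step : (cy : SDCycle G) (j : Fin (suc (len cy))) → ∃[ j′ ] Step G (edges cy j) (nodes cy j) (nodes cy j′)
  cycle-step cy j with inject₁-or-fromℕ j
  ... | inj₁ (i , refl) = suc i , steps cy i
  ... | inj₂ refl       = zero , close cy

  outdeg-on-cycle : Directed G → (cy : SDCycle G) → ∀ j → 1 ≤ outdeg G (nodes cy j)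
  outdeg-on-cycle directed cy j =
    let Gₑ≡ = directed-step {G = G} directed (proj₂ (cycle-step cy j))
    in outdeg-≥1 G (edges cy j) (cong kind Gₑ≡) (cong src Gₑ≡)

  transport-cycle : ∀ {H : Graph n m} (cy : SDCycle G) → (∀ j → G (edges cy j) ≡ H (edges cy j)) → SDCycle H
  transport-cycle {H} cy G≡H = record
    { len = len cy ; nodes = nodes cy ; edges = edges cy
    ; steps = λ i → transport (G≡H (inject₁ i)) (steps cy i)
    ; close = transport (G≡H (fromℕ (len cy))) (close cy)
    ; nodesInj = nodesInj cy ; edgesInj = edgesInj cy }
    where
    transport : ∀ {e a b} → G e ≡ H e → Step G e a b → Step H e a b
    transport {a = a} {b} eq = subst (λ x → (x ≡ edge D a b) ⊎ (x ≡ edge U a b) ⊎ (x ≡ edge U b a)) eq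

reverse-refines : ∀ {n} {x : Edge n} {a b} → kind x ≡ U → Refines (edge D a b) x → Refines (edge D b a) x
reverse-refines {x = edge U _ _} _ (inj₂ (inj₁ refl)) = inj₂ (inj₂ refl)
reverse-refines {x = edge U _ _} _ (inj₂ (inj₂ refl)) = inj₂ (inj₁ refl)

reverse : ∀ {n} → Edge n → Edge n
reverse (edge k a b) = edge k b a

flipAt : ∀ {n m} → Graph n m → Fin m → Graph n m
flipAt G e₀ e with e ≟ e₀
... | yes _ = reverse (G e)
... | no  _ = G e

flipAt-view : ∀ {n m} (G : Graph n m) e₀ e →
              (e ≡ e₀ × flipAt G e₀ e ≡ reverse (G e₀)) ⊎ (e ≢ e₀ × flipAt G e₀ e ≡ G e)
flipAt-view G e₀ e with e ≟ e₀
... | yes refl  = inj₁ (refl , refl)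
... | no  e≢e₀ = inj₂ (e≢e₀ , refl)

-- If the unique out-edge of a source v of R is undirected in N, reversing it yields a rooted partner
-- in which v is a leaf.
module ReverseOutEdge {n m} {R N : Graph n m} (partner : RootedPartner R N) {v : Fin n}
  (indeg≡0 : indeg R v ≡ 0) (outdeg≡1 : outdeg R v ≡ 1) (N-outdeg≡0 : outdeg N v ≡ 0) where

  open Partner partner

  private
    out-edge : ∃[ e ] outgoing v (R e) ≡ true
    out-edge = count-witness _ (λ outdeg≡0 → case trans (sym outdeg≡1) outdeg≡0 of λ ())

    e₀ : Fin m
    e₀ = proj₁ out-edge

    w : Fin n
    w = tgt (R e₀)

    R-e₀ : R e₀ ≡ edge D v w
    R-e₀ = let kind≡D , src≡v = outgoing-sound (R e₀) (proj₂ out-edge) in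
      cong₂ (λ k s → edge k s w) kind≡D src≡v

    v≢w : v ≢ w
    v≢w v≡w = WellFormed.noLoop (proj₁ R-sdag) e₀ (trans (cong src R-e₀) v≡w)

    only-e₀ : ∀ e → src (R e) ≡ v → e ≡ e₀
    only-e₀ e src≡v = count≡1⇒unique outdeg≡1 (proj₂ out-edge) (isD∧≟-complete (directed e) src≡v)

    no-in-edge : ∀ e → tgt (R e) ≢ v
    no-in-edge e tgt≡v = 1+n≰n (subst (1 ≤_) indeg≡0 (indeg-≥1 R e (directed e) tgt≡v))

    N-e₀-undirected : kind (N e₀) ≡ U
    N-e₀-undirected with kind (N e₀) in kind≡
    ... | U = refl
    ... | D = ⊥-elim (1+n≰n (subst (1 ≤_) N-outdeg≡0 (outdeg-≥1 N e₀ kind≡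
                (trans (cong src (sym (refines-directed e₀ kind≡))) (cong src R-e₀)))))

    w-not-hybrid : ¬ Hybrid R w
    w-not-hybrid hybrid = case trans (sym N-e₀-undirected) (proj₁ (proj₁ (hybridEdges e₀) (directed e₀ , hybrid))) of λ ()

    R′ : Graph n m
    R′ = flipAt R e₀

    R′-view : ∀ e → (e ≡ e₀ × R′ e ≡ edge D w v) ⊎ (e ≢ e₀ × R′ e ≡ R e)
    R′-view e with flipAt-view R e₀ e
    ... | inj₁ (refl , R′ₑ≡) = inj₁ (refl , trans R′ₑ≡ (cong reverse R-e₀))
    ... | inj₂ other          = inj₂ other

    directed′ : Directed R′
    directed′ e with R′-view e
    ... | inj₁ (_ , R′ₑ≡) = cong kind R′ₑ≡
    ... | inj₂ (_ , R′ₑ≡) = trans (cong kind R′ₑ≡) (directed e)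

    leaf′ : IsLeaf R′ v
    leaf′ = count-false not-out
      where
      not-out : ∀ e → outgoing v (R′ e) ≡ false
      not-out e with R′-view e
      ... | inj₁ (_ , R′ₑ≡) rewrite R′ₑ≡ = isYes-complete⁻ (w ≟ v) (λ w≡v → v≢w (sym w≡v))
      ... | inj₂ (e≢e₀ , R′ₑ≡) rewrite R′ₑ≡ | directed e =
        isYes-complete⁻ (src (R e) ≟ v) (λ src≡v → e≢e₀ (only-e₀ e src≡v))

    wellFormed′ : WellFormed R′
    wellFormed′ = record
      { noLoop      = loopless
      ; undirSimple = λ e _ kind≡U _ _ → case trans (sym kind≡U) (directed′ e) of λ () }
      where
      loopless : ∀ e → src (R′ e) ≢ tgt (R′ e)
      loopless e with R′-view e
      ... | inj₁ (_ , R′ₑ≡) = λ eq → v≢w (sym (trans (sym (cong src R′ₑ≡)) (trans eq (cong tgt R′ₑ≡))))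
      ... | inj₂ (_ , R′ₑ≡) = λ eq → WellFormed.noLoop (proj₁ R-sdag) e
                                       (trans (sym (cong src R′ₑ≡)) (trans eq (cong tgt R′ₑ≡)))

    -- A cycle of R′ avoids the leaf v, hence the reversed edge (which ends in v), so it is a cycle of R.
    acyclic′ : Acyclic R′
    acyclic′ cy = proj₂ R-sdag (transport-cycle cy λ j → avoids-e₀ j)
      where
      open SDCycle cy
      avoids-e₀ : ∀ j → R′ (edges j) ≡ R (edges j)
      avoids-e₀ j with R′-view (edges j)
      ... | inj₂ (_ , R′ₑ≡) = R′ₑ≡
      ... | inj₁ (_ , R′ₑ≡) with j′ , s ← cycle-step cy j =
        let next≡v = sym (cong tgt (trans (sym R′ₑ≡) (directed-step {G = R′} directed′ {edges j} s)))
        in ⊥-elim (1+n≰n (subst (1 ≤_) leaf′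
                              (subst (λ x → 1 ≤ outdeg R′ x) next≡v (outdeg-on-cycle directed′ cy j′))))

    compatible′ : Compatible R′ N
    compatible′ e with R′-view e
    ... | inj₁ (refl , R′ₑ≡) = subst (λ x → Refines x (N e₀)) (sym R′ₑ≡)
                                  (reverse-refines N-e₀-undirected (subst (λ x → Refines x (N e₀)) R-e₀ (compatible e₀)))
    ... | inj₂ (_ , R′ₑ≡)    = subst (λ x → Refines x (N e)) (sym R′ₑ≡) (compatible e)

    indeg′-≤ : ∀ x → x ≢ v → indeg R′ x ≤ indeg R x
    indeg′-≤ x x≢v = count-mono λ e inₑ → case R′-view e of λ where
      (inj₁ (_ , R′ₑ≡)) → ⊥-elim (x≢v (sym (trans (sym (cong tgt R′ₑ≡)) (proj₂ (incoming-sound (R′ e) inₑ)))))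
      (inj₂ (_ , R′ₑ≡)) → subst (λ y → incoming x y ≡ true) R′ₑ≡ inₑ

    indeg-≤′ : ∀ x → x ≢ w → indeg R x ≤ indeg R′ x
    indeg-≤′ x x≢w = count-mono λ e inₑ → case R′-view e of λ where
      (inj₁ (refl , _)) → ⊥-elim (x≢w (sym (proj₂ (incoming-sound (R e₀) inₑ))))
      (inj₂ (_ , R′ₑ≡)) → subst (λ y → incoming x y ≡ true) (sym R′ₑ≡) inₑ

    indeg′-v : indeg R′ v ≤ 1
    indeg′-v = count-≤1 e₀ λ e inₑ → case R′-view e of λ where
      (inj₁ (e≡e₀ , _))   → e≡e₀
      (inj₂ (_ , R′ₑ≡)) →
        ⊥-elim (no-in-edge e (proj₂ (incoming-sound (R e) (subst (λ y → incoming v y ≡ true) R′ₑ≡ inₑ))))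

    hybridEdges′ : ∀ e → (HybridEdge R′ e → HybridEdge N e) × (HybridEdge N e → HybridEdge R′ e)
    hybridEdges′ e = to , from
      where
      to : HybridEdge R′ e → HybridEdge N e
      to (_ , hybrid) with R′-view e
      ... | inj₁ (_ , R′ₑ≡) =
        ⊥-elim (<⇒≱ hybrid (subst (λ x → indeg R′ x ≤ 1) (sym (cong tgt R′ₑ≡)) indeg′-v))
      ... | inj₂ (_ , R′ₑ≡) rewrite R′ₑ≡ =
        proj₁ (hybridEdges e) (directed e , ≤-trans hybrid (indeg′-≤ _ (no-in-edge e)))
      from : HybridEdge N e → HybridEdge R′ e
      from hybridN with proj₂ (hybridEdges e) hybridN | R′-view e
      ... | _ , _ | inj₁ (refl , _) = case trans (sym N-e₀-undirected) (proj₁ hybridN) of λ ()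
      ... | _ , hybrid | inj₂ (_ , R′ₑ≡) rewrite R′ₑ≡ =
        directed e , ≤-trans hybrid (indeg-≤′ _ (λ tgt≡w → w-not-hybrid (subst (Hybrid R) tgt≡w hybrid)))

  unrootedLeaf : UnrootedLeaf N v
  unrootedLeaf = R′ , ((sdag′ , directed′) , sdag′ , N-sdag , compatible′ , hybridEdges′) , leaf′
    where
    sdag′ : SDAG R′
    sdag′ = wellFormed′ , acyclic′

module _ {n m} (G : Graph n m) where

  isSource? isIndegOne? isLeaf? : Fin n → Bool
  isSource?   v = ⌊ indeg G v ℕ.≟ 0 ⌋
  isIndegOne? v = ⌊ indeg G v ℕ.≟ 1 ⌋
  isLeaf?     v = ⌊ outdeg G v ℕ.≟ 0 ⌋

  numSources numIndegOne numLeaves : ℕ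
  numSources  = count isSource?
  numIndegOne = count isIndegOne?
  numLeaves   = count isLeaf?

indeg-partition : ∀ {n m} (G : Graph n m) → numSources G + numIndegOne G + numHybrid G ≡ n
indeg-partition {n} G = begin
  numSources G + numIndegOne G + numHybrid G
    ≡⟨ cong₂ _+_ (cong₂ _+_ (count≡sumF-ind (isSource? G)) (count≡sumF-ind (isIndegOne? G)))
                 (count≡sumF-ind (isHybrid G)) ⟩
  sumF (λ v → ind (isSource? G v)) + sumF (λ v → ind (isIndegOne? G v)) + sumF (λ v → ind (isHybrid G v))
    ≡⟨ sumF-+₃ (λ v → ind (isSource? G v)) (λ v → ind (isIndegOne? G v)) (λ v → ind (isHybrid G v)) ⟨
  sumF (λ v → ind (isSource? G v) + ind (isIndegOne? G v) + ind (isHybrid G v))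
    ≡⟨ sumF-cong (λ v → exactly-one (indeg G v)) ⟩
  sumF {n} (λ _ → 1)
    ≡⟨ sumF-one ⟩
  n ∎
  where
  open ≡-Reasoning
  exactly-one : ∀ x → ind ⌊ x ℕ.≟ 0 ⌋ + ind ⌊ x ℕ.≟ 1 ⌋ + ind ⌊ 2 ≤? x ⌋ ≡ 1
  exactly-one 0             = refl
  exactly-one 1             = refl
  exactly-one (suc (suc x)) = refl

edges≡indegOne+sumHybIndeg : ∀ {n m} {G : Graph n m} → Directed G → m ≡ numIndegOne G + sumHybIndeg G
edges≡indegOne+sumHybIndeg {G = G} directed = begin
  _                                                                     ≡⟨ sumF-indeg {G = G} directed ⟨
  sumF (indeg G)                                                        ≡⟨ sumF-cong (λ v → split (indeg G v)) ⟩
  sumF (λ v → ind (isIndegOne? G v) + (if isHybrid G v then indeg G v else 0))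
                                                                        ≡⟨ sumF-+ (λ v → ind (isIndegOne? G v)) _ ⟩
  sumF (λ v → ind (isIndegOne? G v)) + sumHybIndeg G
                                                                        ≡⟨ cong (_+ sumHybIndeg G) (count≡sumF-ind (isIndegOne? G)) ⟨
  numIndegOne G + sumHybIndeg G                                         ∎
  where
  open ≡-Reasoning
  split : ∀ x → x ≡ ind ⌊ x ℕ.≟ 1 ⌋ + (if ⌊ 2 ≤? x ⌋ then x else 0)
  split 0             = refl
  split 1             = refl
  split (suc (suc x)) = refl

-- Each node accounts for 2 in the sum of twice its leaf indicator, its hybrid indicator and its out-degree.
2*nodes≤ : ∀ {n m} {G : Graph n m} → Directed G → (∀ v → TreeNode G v → outdeg G v ≢ 0 → 2 ≤ outdeg G v) →
           2 * n ≤ 2 * numLeaves G + numHybrid G + m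
2*nodes≤ {n} {m} {G} directed branching = begin
  2 * n                                 ≡⟨ cong (2 *_) (sumF-one {n}) ⟨
  2 * sumF {n} (λ _ → 1)                ≡⟨ sumF-* {n} 2 (λ _ → 1) ⟨
  sumF {n} (λ _ → 2)                    ≤⟨ sumF-mono (λ v → node-share (indeg G v) (outdeg G v) (branching v)) ⟩
  sumF (λ v → 2 * ind (isLeaf? G v) + ind (isHybrid G v) + outdeg G v)
    ≡⟨ sumF-+₃ (λ v → 2 * ind (isLeaf? G v)) (λ v → ind (isHybrid G v)) (outdeg G) ⟩
  sumF (λ v → 2 * ind (isLeaf? G v)) + sumF (λ v → ind (isHybrid G v)) + sumF (outdeg G)
    ≡⟨ cong₂ _+_ (cong₂ _+_ (trans (sumF-* 2 (λ v → ind (isLeaf? G v))) (cong (2 *_) (sym (count≡sumF-ind (isLeaf? G)))))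
                            (sym (count≡sumF-ind (isHybrid G))))
                 (sumF-outdeg {G = G} directed) ⟩
  2 * numLeaves G + numHybrid G + m     ∎
  where
  open ≤-Reasoning
  node-share : ∀ a o → (a ≤ 1 → o ≢ 0 → 2 ≤ o) → 2 ≤ 2 * ind ⌊ o ℕ.≟ 0 ⌋ + ind ⌊ 2 ≤? a ⌋ + o
  node-share a 0       _ = s≤s (s≤s z≤n)
  node-share a (suc o) tree⇒2≤ with 2 ≤? a
  ... | yes _   = s≤s (s≤s z≤n)
  ... | no  2≰a = tree⇒2≤ (≤-pred (≰⇒> 2≰a)) (λ ())

sumHybIndeg≤ : ∀ {n m} {G : Graph n m} {k} → (∀ v → Hybrid G v → indeg G v ≤ k) → sumHybIndeg G ≤ k * numHybrid G
sumHybIndeg≤ {G = G} {k} bounded = begin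
  sumHybIndeg G                            ≤⟨ sumF-mono (λ v → bound (indeg G v) (bounded v)) ⟩
  sumF (λ v → k * ind (isHybrid G v))      ≡⟨ sumF-* k (λ v → ind (isHybrid G v)) ⟩
  k * sumF (λ v → ind (isHybrid G v))      ≡⟨ cong (k *_) (count≡sumF-ind (isHybrid G)) ⟨
  k * numHybrid G                          ∎
  where
  open ≤-Reasoning
  bound : ∀ a → (2 ≤ a → a ≤ k) → (if ⌊ 2 ≤? a ⌋ then a else 0) ≤ k * ind ⌊ 2 ≤? a ⌋
  bound a a≤k with 2 ≤? a
  ... | yes 2≤a = ≤-trans (a≤k 2≤a) (≤-reflexive (sym (*-identityʳ k)))
  ... | no  _   = z≤n

-- The tree child of a non-leaf has the non-leaf as its unique parent, so this is an injection.
nodes≤leaves+indegOne : ∀ {n m} {G : Graph n m} → TreeChild G → n ≤ numLeaves G + numIndegOne G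
nodes≤leaves+indegOne {n} {m} {G} treeChild = begin
  n                                                ≡⟨ count-complement (isLeaf? G) ⟨
  numLeaves G + count (λ v → not (isLeaf? G v))    ≤⟨ +-monoʳ-≤ (numLeaves G) nonLeaves≤ ⟩
  numLeaves G + numIndegOne G                      ∎
  where
  open ≤-Reasoning
  NonLeaf : Fin n → Set
  NonLeaf v = not (isLeaf? G v) ≡ true
  childEdge : ∀ v → NonLeaf v → ∃[ e ] (kind (G e) ≡ D × src (G e) ≡ v × TreeNode G (tgt (G e)))
  childEdge v nonLeaf = treeChild v λ outdeg≡0 →
    case trans (sym nonLeaf) (cong not (isYes-complete (outdeg G v ℕ.≟ 0) outdeg≡0)) of λ ()
  child : ∀ v → NonLeaf v → Fin n
  child v nonLeaf = tgt (G (proj₁ (childEdge v nonLeaf)))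
  child-indeg≡1 : ∀ v nonLeaf → indeg G (child v nonLeaf) ≡ 1
  child-indeg≡1 v nonLeaf with e , kind≡D , _ , tree ← childEdge v nonLeaf = ≤-antisym tree (indeg-≥1 G e kind≡D refl)
  parent-unique : ∀ v w nonLeafᵥ nonLeaf_w → child v nonLeafᵥ ≡ child w nonLeaf_w → v ≡ w
  parent-unique v w nonLeafᵥ nonLeaf_w child≡ =
    let e , kind≡D , src≡v , _  = childEdge v nonLeafᵥ
        f , kind≡D′ , src≡w , _ = childEdge w nonLeaf_w
        f≡e = count≡1⇒unique (child-indeg≡1 v nonLeafᵥ)
                (isD∧≟-complete kind≡D refl) (isD∧≟-complete kind≡D′ (sym child≡))
    in trans (sym src≡v) (trans (cong (λ e → src (G e)) (sym f≡e)) src≡w)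
  nonLeaves≤ : count (λ v → not (isLeaf? G v)) ≤ numIndegOne G
  nonLeaves≤ = count-≤-injection _ _ child
    (λ v nonLeaf → isYes-complete (indeg G (child v nonLeaf) ℕ.≟ 1) (child-indeg≡1 v nonLeaf)) parent-unique

module _ {n m} {R N : Graph n m} (partner : RootedPartner R N) where
  open Partner partner

  leaves≤labels : ∀ {k} → LNetwork N k → numLeaves R ≤ k
  leaves≤labels {k} (_ , _ , unrooted⇒rooted , label , _ , _ , labelled) =
    subst (numLeaves R ≤_) count-const-true
      (count-≤-injection (isLeaf? R) (λ (_ : Fin k) → true) (λ v leaf → proj₁ (labelOf v leaf)) (λ _ _ → refl)
        (λ v w leafᵥ leaf_w i≡j →
           trans (sym (proj₂ (labelOf v leafᵥ))) (trans (cong label i≡j) (proj₂ (labelOf w leaf_w)))))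
    where
    labelOf : ∀ v → isLeaf? R v ≡ true → ∃[ i ] label i ≡ v
    labelOf v leaf = labelled v (unrooted⇒rooted v (R , partner , isYes-sound (outdeg R v ℕ.≟ 0) leaf))

  -- Distinct root components lie below distinct sources of R.
  roots≤sources : ∀ {t} → HasRootComponents N t → t ≤ numSources R
  roots≤sources {t} (rep , rep-root , rep-distinct , _) =
    subst (_≤ numSources R) count-const-true
      (count-≤-injection (λ (_ : Fin t) → true) _ (λ i _ → source i)
        (λ i _ → isYes-complete (indeg R (source i) ℕ.≟ 0) (proj₁ (proj₂ (above i))))
        (λ i j _ _ sᵢ≡sⱼ → rep-distinct i j
          ( up j ++ₚ subst (λ s → Path N s (rep i)) sᵢ≡sⱼ (down i)
          , up i ++ₚ subst (λ s → Path N s (rep j)) (sym sᵢ≡sⱼ) (down j))))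
    where
    above : ∀ i → ∃[ s ] (indeg R s ≡ 0 × Path R s (rep i))
    above i = source-above (proj₂ R-sdag) (rep i)
    source : Fin t → Fin n
    source i = proj₁ (above i)
    down : ∀ i → Path N (source i) (rep i)
    down i = lift-path (proj₂ (proj₂ (above i)))
    up : ∀ i → Path N (rep i) (source i)
    up i = rep-root i (source i) (down i)

  -- A tree node of R with a single child is elementary in N, unless it is a source whose out-edge is
  -- undirected in N; reversing that edge makes it a leaf of another rooted partner.
  single-child-elementary : (∀ v → UnrootedLeaf N v → RootedLeaf N v) →
                            ∀ {v} → TreeNode R v → outdeg R v ≡ 1 → Elementary N v
  single-child-elementary unrooted⇒rooted {v} tree outdeg≡1 = case ≤1⇒≡0⊎≡1 tree of λ where
      (inj₂ indeg≡1) → N-tree , inj₂ (subst (outdeg N v <_) (sym (deg≡ indeg≡1)) (s≤s N-outdeg≤1) , deg≡ indeg≡1)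
      (inj₁ indeg≡0) → case ≤1⇒≡0⊎≡1 N-outdeg≤1 of λ where
        (inj₂ N-outdeg≡1) → N-tree , inj₁ (N-outdeg≡1 , deg≡ indeg≡0)
        (inj₁ N-outdeg≡0) →
          let leaf = unrooted⇒rooted v (ReverseOutEdge.unrootedLeaf partner indeg≡0 outdeg≡1 N-outdeg≡0) R partner
          in case trans (sym outdeg≡1) leaf of λ ()
    where
    N-tree : TreeNode N v
    N-tree = ≤-trans (indeg-≤ v) tree
    N-outdeg≤1 : outdeg N v ≤ 1
    N-outdeg≤1 = ≤-trans (outdeg-≤ v) (≤-reflexive outdeg≡1)
    deg≡ : ∀ {a} → indeg R v ≡ a → deg N v ≡ a + 1
    deg≡ indeg≡a = trans (deg-≡ v) (cong₂ _+_ indeg≡a outdeg≡1)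

  branching : (∀ v → UnrootedLeaf N v → RootedLeaf N v) → (∀ v → ¬ Elementary N v) →
              ∀ v → TreeNode R v → outdeg R v ≢ 0 → 2 ≤ outdeg R v
  branching unrooted⇒rooted noElementary v tree outdeg≢0 with outdeg R v in outdeg≡
  ... | 0           = ⊥-elim (outdeg≢0 refl)
  ... | 1           = ⊥-elim (noElementary v (single-child-elementary unrooted⇒rooted tree outdeg≡))
  ... | suc (suc _) = s≤s (s≤s z≤n)

  maxHybIndeg-bound : ∀ {k} → IsMaxHybIndeg N k → ∀ v → Hybrid R v → indeg R v ≤ k
  maxHybIndeg-bound (_ , maximal) v hybrid =
    subst (_≤ _) (indeg-hybrid v hybrid) (maximal v (subst (2 ≤_) (sym (indeg-hybrid v hybrid)) hybrid))

maxHybIndeg-positive : ∀ {n m} {G : Graph n m} {k} → IsMaxHybIndeg G k → 1 ≤ k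
maxHybIndeg-positive ((_ , hybrid , indeg≡k) , _) = ≤-trans (s≤s z≤n) (subst (2 ≤_) indeg≡k hybrid)

-- nV, nE: nodes and edges; s, t₁, h, l: sources, nodes of in-degree one, hybrids and leaves of a rooted
-- partner; S: the sum of the hybrid in-degrees.
module Estimates (nV nE s t₁ h l S : ℕ) where

  hybrids+sources≤leaves : s + t₁ + h ≡ nV → nV ≤ l + t₁ → h + s ≤ l
  hybrids+sources≤leaves nodes nV≤ = +-cancelʳ-≤ t₁ (h + s) l (begin
    h + s + t₁  ≡⟨ rearrange h s t₁ ⟩
    s + t₁ + h  ≡⟨ nodes ⟩
    nV          ≤⟨ nV≤ ⟩
    l + t₁      ∎)
    where
    open ≤-Reasoning
    rearrange : ∀ h s t₁ → h + s + t₁ ≡ s + t₁ + h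
    rearrange = solve-∀

  degree-inequality : s + t₁ + h ≡ nV → nE ≡ t₁ + S →
                      2 * nV ≤ 2 * l + h + nE → t₁ + h + 2 * s ≤ S + 2 * l
  degree-inequality nodes edges 2nV≤ =
    +-cancelʳ-≤ (t₁ + h) (t₁ + h + 2 * s) (S + 2 * l) (begin
      t₁ + h + 2 * s + (t₁ + h)  ≡⟨ double s t₁ h ⟩
      2 * (s + t₁ + h)           ≡⟨ cong (2 *_) nodes ⟩
      2 * nV                     ≤⟨ 2nV≤ ⟩
      2 * l + h + nE             ≡⟨ cong (2 * l + h +_) edges ⟩
      2 * l + h + (t₁ + S)       ≡⟨ regroup t₁ S l h ⟩
      S + 2 * l + (t₁ + h)       ∎)
    where
    open ≤-Reasoning
    double : ∀ s t₁ h → t₁ + h + 2 * s + (t₁ + h) ≡ 2 * (s + t₁ + h)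
    double = solve-∀
    regroup : ∀ t₁ S l h → 2 * l + h + (t₁ + S) ≡ S + 2 * l + (t₁ + h)
    regroup = solve-∀

  hybrids+roots≤k : ∀ {t k} → h + s ≤ l → t ≤ s → l ≤ k → h + t ≤ k
  hybrids+roots≤k h+s≤l t≤s l≤k = ≤-trans (+-monoʳ-≤ h t≤s) (≤-trans h+s≤l l≤k)

  nodes+roots≤ : ∀ {t k} → s + t₁ + h ≡ nV → t₁ + h + 2 * s ≤ S + 2 * l → t ≤ s → l ≤ k →
                 nV + t ≤ 2 * k + S
  nodes+roots≤ {t} {k} nodes degrees t≤s l≤k = begin
    nV + t              ≤⟨ +-monoʳ-≤ nV t≤s ⟩
    nV + s              ≡⟨ cong (_+ s) nodes ⟨
    s + t₁ + h + s      ≡⟨ rearrange s t₁ h ⟩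
    t₁ + h + 2 * s      ≤⟨ degrees ⟩
    S + 2 * l           ≤⟨ +-monoʳ-≤ S (*-monoʳ-≤ 2 l≤k) ⟩
    S + 2 * k           ≡⟨ +-comm S (2 * k) ⟩
    2 * k + S           ∎
    where
    open ≤-Reasoning
    rearrange : ∀ s t₁ h → s + t₁ + h + s ≡ t₁ + h + 2 * s
    rearrange = solve-∀

  nodes+roots≤-maxIndeg : ∀ m {t k} → S ≤ m * h → h + t ≤ k →
                          2 * k + S + (m + 2) * t ≤ (m + 2) * k + 2 * t
  nodes+roots≤-maxIndeg m {t} {k} S≤mh h+t≤k = begin
    2 * k + S + (m + 2) * t     ≡⟨ split₁ k S m t ⟩
    2 * k + 2 * t + (S + m * t) ≤⟨ +-monoʳ-≤ (2 * k + 2 * t) (+-monoˡ-≤ (m * t) S≤mh) ⟩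
    2 * k + 2 * t + (m * h + m * t) ≡⟨ cong (2 * k + 2 * t +_) (*-distribˡ-+ m h t) ⟨
    2 * k + 2 * t + m * (h + t) ≤⟨ +-monoʳ-≤ (2 * k + 2 * t) (*-monoʳ-≤ m h+t≤k) ⟩
    2 * k + 2 * t + m * k       ≡⟨ split₂ k t m ⟩
    (m + 2) * k + 2 * t         ∎
    where
    open ≤-Reasoning
    split₁ : ∀ k S m t → 2 * k + S + (m + 2) * t ≡ 2 * k + 2 * t + (S + m * t)
    split₁ = solve-∀
    split₂ : ∀ k t m → 2 * k + 2 * t + m * k ≡ (m + 2) * k + 2 * t
    split₂ = solve-∀

  edges+hybrids≤ : ∀ m → nE ≡ t₁ + S → t₁ + h + 2 * s ≤ S + 2 * l → S ≤ m * h →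
                   nE + h + 2 * s ≤ 2 * (m * h) + 2 * l
  edges+hybrids≤ m edges degrees S≤mh = begin
    nE + h + 2 * s          ≡⟨ cong (λ e → e + h + 2 * s) edges ⟩
    t₁ + S + h + 2 * s      ≡⟨ rearrange t₁ S h s ⟩
    S + (t₁ + h + 2 * s)    ≤⟨ +-monoʳ-≤ S degrees ⟩
    S + (S + 2 * l)         ≤⟨ +-mono-≤ S≤mh (+-monoˡ-≤ (2 * l) S≤mh) ⟩
    m * h + (m * h + 2 * l) ≡⟨ regroup (m * h) l ⟩
    2 * (m * h) + 2 * l     ∎
    where
    open ≤-Reasoning
    rearrange : ∀ t₁ S h s → t₁ + S + h + 2 * s ≡ S + (t₁ + h + 2 * s)
    rearrange = solve-∀
    regroup : ∀ x l → x + (x + 2 * l) ≡ 2 * x + 2 * l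
    regroup = solve-∀

  -- After adding h + 2 s to both sides and writing m = m′ + 1, this reduces to (2 m′ + 1) (h + s) ≤ (2 m′ + 1) l.
  edges+roots≤ : ∀ {t k m} → 1 ≤ m → nE + h + 2 * s ≤ 2 * (m * h) + 2 * l →
                 h + s ≤ l → t ≤ s → l ≤ k → nE + (2 * m + 1) * t ≤ (2 * m + 1) * k
  edges+roots≤ {t} {k} {suc m′} (s≤s z≤n) edges≤ h+s≤l t≤s l≤k =
    +-cancelʳ-≤ (h + 2 * s) (nE + (2 * m + 1) * t) ((2 * m + 1) * k) (begin
      nE + (2 * m + 1) * t + (h + 2 * s)       ≤⟨ +-monoˡ-≤ (h + 2 * s) (+-monoʳ-≤ nE (*-monoʳ-≤ (2 * m + 1) t≤s)) ⟩
      nE + (2 * m + 1) * s + (h + 2 * s)       ≡⟨ rearrange nE (2 * m + 1) s h ⟩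
      nE + h + 2 * s + (2 * m + 1) * s         ≤⟨ +-monoˡ-≤ ((2 * m + 1) * s) edges≤ ⟩
      2 * (m * h) + 2 * l + (2 * m + 1) * s    ≡⟨ expand m′ h l s ⟩
      (2 * m′ + 1) * (h + s) + 2 * l + (h + 2 * s)
        ≤⟨ +-monoˡ-≤ (h + 2 * s) (+-monoˡ-≤ (2 * l) (*-monoʳ-≤ (2 * m′ + 1) h+s≤l)) ⟩
      (2 * m′ + 1) * l + 2 * l + (h + 2 * s)   ≡⟨ cong (_+ (h + 2 * s)) (collect m′ l) ⟩
      (2 * m + 1) * l + (h + 2 * s)            ≤⟨ +-monoˡ-≤ (h + 2 * s) (*-monoʳ-≤ (2 * m + 1) l≤k) ⟩
      (2 * m + 1) * k + (h + 2 * s)            ∎)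
    where
    m = suc m′
    open ≤-Reasoning
    rearrange : ∀ e c s h → e + c * s + (h + 2 * s) ≡ e + h + 2 * s + c * s
    rearrange = solve-∀
    expand : ∀ m′ h l s →
             2 * ((1 + m′) * h) + 2 * l + (2 * (1 + m′) + 1) * s ≡ (2 * m′ + 1) * (h + s) + 2 * l + (h + 2 * s)
    expand = solve-∀
    collect : ∀ m′ l → (2 * m′ + 1) * l + 2 * l ≡ (2 * (1 + m′) + 1) * l
    collect = solve-∀

proposition14 : ∀ {nV nE k t : ℕ} (N : Graph nV nE) →
    LNetwork N k → StronglyTreeChild N → HasRootComponents N t →
    (numHybrid N + t ≤ k) ×
    ((∀ v → ¬ Elementary N v) →
      (nV + t ≤ 2 * k + sumHybIndeg N) ×
      (∀ m → IsMaxHybIndeg N m →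
        (2 * k + sumHybIndeg N + (m + 2) * t ≤ (m + 2) * k + 2 * t) ×
        (nE + (2 * m + 1) * t ≤ (2 * m + 1) * k)))
proposition14 {nV} {nE} {k} {t} N lnet@((_ , R , partner) , _ , unrooted⇒rooted , _) (_ , strongly) roots =
  subst (λ h → h + t ≤ k) (sym numHybrid-≡) hybrids+roots≤ ,
  λ noElementary →
    subst (λ S → nV + t ≤ 2 * k + S) (sym sumHybIndeg-≡) (nodes+roots≤ nodes (degrees noElementary) roots≤ leaves≤) ,
    λ m maximal →
      subst (λ S → 2 * k + S + (m + 2) * t ≤ (m + 2) * k + 2 * t) (sym sumHybIndeg-≡)
            (nodes+roots≤-maxIndeg m (hybIndeg≤ maximal) hybrids+roots≤) ,
      edges+roots≤ {m = m} (maxHybIndeg-positive {G = N} maximal)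
                   (edges+hybrids≤ m edges (degrees noElementary) (hybIndeg≤ maximal)) hybrids+sources≤ roots≤ leaves≤
  where
  open Partner partner
  open Estimates nV nE (numSources R) (numIndegOne R) (numHybrid R) (numLeaves R) (sumHybIndeg R)
  nodes : numSources R + numIndegOne R + numHybrid R ≡ nV
  nodes = indeg-partition R
  edges : nE ≡ numIndegOne R + sumHybIndeg R
  edges = edges≡indegOne+sumHybIndeg {G = R} directed
  hybrids+sources≤ : numHybrid R + numSources R ≤ numLeaves R
  hybrids+sources≤ = hybrids+sources≤leaves nodes (nodes≤leaves+indegOne (strongly R partner))
  leaves≤ : numLeaves R ≤ k
  leaves≤ = leaves≤labels partner lnet
  roots≤ : t ≤ numSources R
  roots≤ = roots≤sources partner roots
  hybrids+roots≤ : numHybrid R + t ≤ k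
  hybrids+roots≤ = hybrids+roots≤k hybrids+sources≤ roots≤ leaves≤
  degrees : (∀ v → ¬ Elementary N v) → numIndegOne R + numHybrid R + 2 * numSources R ≤ sumHybIndeg R + 2 * numLeaves R
  degrees noElementary = degree-inequality nodes edges (2*nodes≤ directed (branching partner unrooted⇒rooted noElementary))
  hybIndeg≤ : ∀ {m} → IsMaxHybIndeg N m → sumHybIndeg R ≤ m * numHybrid R
  hybIndeg≤ {m} maximal = sumHybIndeg≤ {G = R} {m} (maxHybIndeg-bound partner maximal)
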